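{- Let $G=(V,E)$, $n,m$, $t$ and $\mathcal{M}(G)$ be as in the context. If $G$ has a three-coloring, then $\delta_n(\mathcal{M}(G))\leqslant\sqrt{mt^2+4nt^6+mt^{10}}$.
   Context: $G=(V,E)$ is a simple graph with $n=|V|\geqslant1$ vertices and $m=|E|\geqslant1$ edges. A three-coloring of $G$ is a map $\varphi:V\to\{1,2,3\}$ with $\varphi(u)\neq\varphi(v)$ whenever $\{u,v\}\in E$. $\|\cdot\|$ is the Frobenius norm; for $M\in\mathbb{R}^{r\times c}$ and $k\leqslant c$, $\delta_k(M)=\min_{S,A}\|M-SA\|$ with $A\in\mathbb{R}^{k\times c}$ and $S$ ranging over $r\times k$ submatrices of $M$ consisting of $k$ of its columns. Set $t=\frac{1}{4(m+n)^3}$. For $i\in\{1,2,3\}$ let $V^i=\{v^i: v\in V\}$ be a disjoint copy of $V$. The matrix $\mathcal{M}=\mathcal{M}(G)$ has rows indexed by $V\cup\{1,2,3\}\cup\{\varepsilon\}$ and columns indexed by $V^1\cup V^2\cup V^3\cup E$, with entries, for all distinct $u,v\in V$, distinct $i,j\in\{1,2,3\}$, and $e\in E$: $\mathcal{M}(u,u^i)=1$, $\mathcal{M}(u,v^i)=0$; $\mathcal{M}(u,e)=t^2$ if $u\in e$ and $0$ otherwise; $\mathcal{M}(i,v^i)=t^3$, $\mathcal{M}(i,v^j)=0$, $\mathcal{M}(i,e)=t^5$; $\mathcal{M}(\varepsilon,v^i)=0$, $\mathcal{M}(\varepsilon,e)=t$. -}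

module Defs where

open import Data.Nat as ℕ using (ℕ; zero; suc)
open import Data.Integer using (+_)
open import Data.Rational using (ℚ; _/_; 0ℚ; 1ℚ; _+_; _*_; _-_)
open import Data.Fin using (Fin; _≟_)
open import Data.Product using (_×_; _,_; proj₁; proj₂)
open import Data.Sum using (_⊎_; inj₁; inj₂)
open import Data.Unit using (⊤; tt)
open import Relation.Nullary using (¬_; yes; no; _because_)
open import Relation.Nullary.Decidable using (_⊎-dec_)
open import Relation.Binary.PropositionalEquality using (_≡_; _≢_)

record SimpleGraph (n m : ℕ) : Set where
  field
    ends      : Fin m → Fin n × Fin n
    noLoop    : ∀ e → proj₁ (ends e) ≢ proj₂ (ends e)
    noMulti   : ∀ e e' → e ≢ e' →
                ¬ ((proj₁ (ends e) ≡ proj₁ (ends e') × proj₂ (ends e) ≡ proj₂ (ends e'))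
                  ⊎ (proj₁ (ends e) ≡ proj₂ (ends e') × proj₂ (ends e) ≡ proj₁ (ends e')))
open SimpleGraph public

IsThreeColoring : ∀ {n m} → SimpleGraph n m → (Fin n → Fin 3) → Set
IsThreeColoring G φ = ∀ e → φ (proj₁ (ends G e)) ≢ φ (proj₂ (ends G e))

ThreeColorable : ∀ {n m} → SimpleGraph n m → Set
ThreeColorable {n} G = Data.Product.Σ (Fin n → Fin 3) (IsThreeColoring G)

fromℕ : ℕ → ℚ
fromℕ k = + k / 1

-- 1 / k (with the harmless convention 1/0 := 0; only used for k > 0)
inv : ℕ → ℚ
inv zero = 0ℚ
inv (suc k) = + 1 / suc k

_^_ : ℚ → ℕ → ℚ
x ^ zero = 1ℚ
x ^ suc k = x * (x ^ k)

tpar : ℕ → ℕ → ℚ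
tpar n m = inv (4 ℕ.* ((m ℕ.+ n) ℕ.^ 3))

-- rows: V ∪ {1,2,3} ∪ {ε};  columns: V¹ ∪ V² ∪ V³ ∪ E
Row : ℕ → Set
Row n = Fin n ⊎ (Fin 3 ⊎ ⊤)

Col : ℕ → ℕ → Set
Col n m = (Fin 3 × Fin n) ⊎ Fin m

𝓜 : ∀ {n m} → SimpleGraph n m → Row n → Col n m → ℚ
𝓜 {n} {m} G (inj₁ u) (inj₁ (i , v)) with u ≟ v
... | yes _ = 1ℚ
... | no _ = 0ℚ
𝓜 {n} {m} G (inj₁ u) (inj₂ e) with (u ≟ proj₁ (ends G e)) ⊎-dec (u ≟ proj₂ (ends G e))
... | yes _ = tpar n m ^ 2
... | no _ = 0ℚ
𝓜 {n} {m} G (inj₂ (inj₁ i)) (inj₁ (j , v)) with i ≟ j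
... | yes _ = tpar n m ^ 3
... | no _ = 0ℚ
𝓜 {n} {m} G (inj₂ (inj₁ i)) (inj₂ e) = tpar n m ^ 5
𝓜 {n} {m} G (inj₂ (inj₂ tt)) (inj₁ _) = 0ℚ
𝓜 {n} {m} G (inj₂ (inj₂ tt)) (inj₂ e) = tpar n m

sumFin : ∀ k → (Fin k → ℚ) → ℚ
sumFin zero f = 0ℚ
sumFin (suc k) f = f Fin.zero + sumFin k (λ i → f (Fin.suc i))

sumRow : ∀ n → (Row n → ℚ) → ℚ
sumRow n f = sumFin n (λ u → f (inj₁ u)) + (sumFin 3 (λ i → f (inj₂ (inj₁ i))) + f (inj₂ (inj₂ tt)))

sumCol : ∀ n m → (Col n m → ℚ) → ℚ
sumCol n m f = sumFin 3 (λ i → sumFin n (λ v → f (inj₁ (i , v)))) + sumFin m (λ e → f (inj₂ e))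

-- squared Frobenius norm ‖M - S A‖², where S consists of the columns σ 0 … σ (k-1) of M
-- and A is a k × (columns) matrix
residual² : ∀ {n m} k → (Row n → Col n m → ℚ) → (Fin k → Col n m) → (Fin k → Col n m → ℚ) → ℚ
residual² {n} {m} k M σ A =
  sumRow n (λ r → sumCol n m (λ c →
    let d = M r c - sumFin k (λ j → M r (σ j) * A j c) in d * d))

-- Take S to be the columns v^φ(v) and A the V-rows of 𝓜. The V × V^i blocks of 𝓜 are identity
-- matrices, so S A reproduces the V-rows of 𝓜 exactly and vanishes in row ε, which leaves m t²
-- there. In colour row i, S A has t³ in column v^j exactly when φ(v) = i, while 𝓜 has it exactly
-- when j = i; for each vertex these disagree in four of the nine pairs (i, j), costing 4 t⁶.
-- In an edge column e = uv, S A has t⁵ in the rows φ(u) and φ(v), as 𝓜 does, and 0 in the third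
-- colour row, which exists because φ(u) ≠ φ(v); this costs t¹⁰. The bound holds with equality.
module Submission where

open import Defs
open import Data.Nat using (ℕ; _≤_)
open import Data.Rational using (ℚ; _+_; _*_) renaming (_≤_ to _≤ℚ_)
open import Data.Fin using (Fin)
open import Data.Product using (Σ; _×_)
open import Function.Definitions using (Injective)
open import Function using (_∘_)
open import Relation.Binary.PropositionalEquality using (_≡_)

import Data.Nat as ℕ
import Data.Nat.Properties as ℕ
import Data.Integer as ℤ
import Data.Nat.Coprimality as Coprimality
open import Data.Rational using (_-_; 0ℚ; 1ℚ; mkℚ)
open import Data.Rational.Properties
  using (normalize-coprime; /-cong; +-identityˡ; +-identityʳ; +-assoc; +-comm; +-inverseʳ;
         *-identityˡ; *-identityʳ; *-zeroˡ; *-zeroʳ; *-distribʳ-+; ≤-reflexive)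
open import Data.Rational.Solver using (module +-*-Solver)
open import Data.Fin using (zero; suc; _≟_)
open import Data.Fin.Patterns using (0F; 1F; 2F)
open import Data.Fin.Properties using (suc-injective)
open import Data.Product using (_,_; proj₁; proj₂)
open import Data.Sum using (inj₁; inj₂)
open import Data.Unit using (tt)
open import Data.Empty using (⊥-elim)
open import Relation.Nullary using (yes; no)
open import Relation.Nullary.Decidable using (_⊎-dec_)
open import Relation.Binary.PropositionalEquality using (refl; sym; trans; cong; cong₂; _≢_; module ≡-Reasoning)

open +-*-Solver

pattern vertexRow u    = inj₁ u
pattern colourRow i    = inj₂ (inj₁ i)
pattern εRow           = inj₂ (inj₂ tt)
pattern vertexCol i v  = inj₁ (i , v)
pattern edgeCol e      = inj₂ e

fromℕ≡mkℚ : ∀ k → fromℕ k ≡ mkℚ (ℤ.+ k) 0 (Coprimality.sym (Coprimality.1-coprimeTo k))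
fromℕ≡mkℚ k = normalize-coprime (Coprimality.sym (Coprimality.1-coprimeTo k))

fromℕ-suc : ∀ k → fromℕ (ℕ.suc k) ≡ 1ℚ + fromℕ k
fromℕ-suc ℕ.zero = refl
fromℕ-suc k@(ℕ.suc _) rewrite fromℕ≡mkℚ k =
  sym (/-cong {p₁ = ℤ.+ 1 ℤ.+ ℤ.+ (k ℕ.* 1)} {q₁ = 1} (cong (λ x → ℤ.+ ℕ.suc x) (ℕ.*-identityʳ k)) refl)

fromℕ-+ : ∀ a b → fromℕ (a ℕ.+ b) ≡ fromℕ a + fromℕ b
fromℕ-+ ℕ.zero    b = sym (+-identityˡ (fromℕ b))
fromℕ-+ (ℕ.suc a) b = begin
  fromℕ (ℕ.suc (a ℕ.+ b))   ≡⟨ fromℕ-suc (a ℕ.+ b) ⟩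
  1ℚ + fromℕ (a ℕ.+ b)      ≡⟨ cong (1ℚ +_) (fromℕ-+ a b) ⟩
  1ℚ + (fromℕ a + fromℕ b)  ≡⟨ sym (+-assoc 1ℚ (fromℕ a) (fromℕ b)) ⟩
  (1ℚ + fromℕ a) + fromℕ b  ≡⟨ cong (_+ fromℕ b) (sym (fromℕ-suc a)) ⟩
  fromℕ (ℕ.suc a) + fromℕ b ∎
  where open ≡-Reasoning

fromℕ-* : ∀ a b → fromℕ (a ℕ.* b) ≡ fromℕ a * fromℕ b
fromℕ-* ℕ.zero    b = sym (*-zeroˡ (fromℕ b))
fromℕ-* (ℕ.suc a) b = begin
  fromℕ (b ℕ.+ a ℕ.* b)               ≡⟨ fromℕ-+ b (a ℕ.* b) ⟩
  fromℕ b + fromℕ (a ℕ.* b)           ≡⟨ cong₂ _+_ (sym (*-identityˡ (fromℕ b))) (fromℕ-* a b) ⟩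
  1ℚ * fromℕ b + fromℕ a * fromℕ b    ≡⟨ sym (*-distribʳ-+ (fromℕ b) 1ℚ (fromℕ a)) ⟩
  (1ℚ + fromℕ a) * fromℕ b            ≡⟨ cong (_* fromℕ b) (sym (fromℕ-suc a)) ⟩
  fromℕ (ℕ.suc a) * fromℕ b           ∎
  where open ≡-Reasoning

sumFin-cong : ∀ k {f g : Fin k → ℚ} → (∀ i → f i ≡ g i) → sumFin k f ≡ sumFin k g
sumFin-cong ℕ.zero    f≗g = refl
sumFin-cong (ℕ.suc k) f≗g = cong₂ _+_ (f≗g zero) (sumFin-cong k (λ i → f≗g (suc i)))

sumFin-zero : ∀ k {f : Fin k → ℚ} → (∀ i → f i ≡ 0ℚ) → sumFin k f ≡ 0ℚ
sumFin-zero ℕ.zero    f≗0 = refl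
sumFin-zero (ℕ.suc k) f≗0 = cong₂ _+_ (f≗0 zero) (sumFin-zero k (λ i → f≗0 (suc i)))

sumFin-distrib-+ : ∀ k (f g : Fin k → ℚ) → sumFin k (λ i → f i + g i) ≡ sumFin k f + sumFin k g
sumFin-distrib-+ ℕ.zero    f g = refl
sumFin-distrib-+ (ℕ.suc k) f g =
  trans (cong (f zero + g zero +_) (sumFin-distrib-+ k (λ i → f (suc i)) (λ i → g (suc i))))
        (solve 4 (λ a b c d → (a :+ b) :+ (c :+ d) := (a :+ c) :+ (b :+ d)) refl (f zero) (g zero) _ _)

sumFin-comm : ∀ a b (f : Fin a → Fin b → ℚ) →
  sumFin a (λ i → sumFin b (f i)) ≡ sumFin b (λ j → sumFin a (λ i → f i j))
sumFin-comm ℕ.zero    b f = sym (sumFin-zero b (λ _ → refl))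
sumFin-comm (ℕ.suc a) b f =
  trans (cong (sumFin b (f zero) +_) (sumFin-comm a b (λ i → f (suc i))))
        (sym (sumFin-distrib-+ b (f zero) (λ j → sumFin a (λ i → f (suc i) j))))

sumFin-const : ∀ k c → sumFin k (λ _ → c) ≡ fromℕ k * c
sumFin-const ℕ.zero    c = sym (*-zeroˡ c)
sumFin-const (ℕ.suc k) c = begin
  c + sumFin k (λ _ → c)   ≡⟨ cong (c +_) (sumFin-const k c) ⟩
  c + fromℕ k * c          ≡⟨ solve 2 (λ c x → c :+ x :* c := (con 1ℚ :+ x) :* c) refl c (fromℕ k) ⟩
  (1ℚ + fromℕ k) * c       ≡⟨ cong (_* c) (sym (fromℕ-suc k)) ⟩
  fromℕ (ℕ.suc k) * c      ∎
  where open ≡-Reasoning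

sumCol-zero : ∀ n m {f : Col n m → ℚ} → (∀ c → f c ≡ 0ℚ) → sumCol n m f ≡ 0ℚ
sumCol-zero n m f≗0 =
  cong₂ _+_ (sumFin-zero 3 (λ i → sumFin-zero n (λ v → f≗0 (vertexCol i v))))
            (sumFin-zero m (λ e → f≗0 (edgeCol e)))

sumFin-single : ∀ k (f : Fin k → ℚ) u → (∀ w → w ≢ u → f w ≡ 0ℚ) → sumFin k f ≡ f u
sumFin-single (ℕ.suc k) f zero    f≗0 =
  trans (cong (f zero +_) (sumFin-zero k (λ w → f≗0 (suc w) (λ ())))) (+-identityʳ (f zero))
sumFin-single (ℕ.suc k) f (suc u) f≗0 =
  trans (cong₂ _+_ (f≗0 zero (λ ())) (sumFin-single k _ u (λ w w≢u → f≗0 (suc w) (w≢u ∘ suc-injective))))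
        (+-identityˡ (f (suc u)))

sumFin-pair : ∀ k (f : Fin k → ℚ) a b → a ≢ b → (∀ w → w ≢ a → w ≢ b → f w ≡ 0ℚ) →
  sumFin k f ≡ f a + f b
sumFin-pair (ℕ.suc k) f zero    zero    a≢b f≗0 = ⊥-elim (a≢b refl)
sumFin-pair (ℕ.suc k) f zero    (suc b) a≢b f≗0 =
  cong (f zero +_) (sumFin-single k _ b (λ w w≢b → f≗0 (suc w) (λ ()) (w≢b ∘ suc-injective)))
sumFin-pair (ℕ.suc k) f (suc a) zero    a≢b f≗0 =
  trans (cong (f zero +_) (sumFin-single k _ a (λ w w≢a → f≗0 (suc w) (w≢a ∘ suc-injective) (λ ()))))
        (+-comm (f zero) (f (suc a)))
sumFin-pair (ℕ.suc k) f (suc a) (suc b) a≢b f≗0 =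
  trans (cong₂ _+_ (f≗0 zero (λ ()) (λ ()))
                   (sumFin-pair k _ a b (a≢b ∘ cong suc)
                                (λ w w≢a w≢b → f≗0 (suc w) (w≢a ∘ suc-injective) (w≢b ∘ suc-injective))))
        (+-identityˡ (f (suc a) + f (suc b)))

colourEntry : ℚ → Fin 3 → Fin 3 → ℚ
colourEntry t i j with i ≟ j
... | yes _ = t ^ 3
... | no  _ = 0ℚ

-- Solver-syntax copies of colourEntry and sumFin 3; the two identities below are then checked by
-- the solver separately for each concrete choice of colours.
private
  colourEntryₚ : ∀ {k} → Fin 3 → Fin 3 → Polynomial k → Polynomial k
  colourEntryₚ i j x with i ≟ j
  ... | yes _ = x :^ 3
  ... | no  _ = con 0ℚ

  sum₃ₚ : ∀ {k} → (Fin 3 → Polynomial k) → Polynomial k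
  sum₃ₚ f = f 0F :+ (f 1F :+ (f 2F :+ con 0ℚ))

  squareₚ : ∀ {k} → Polynomial k → Polynomial k
  squareₚ y = y :* y

  vertexBlockₚ : Fin 3 → Polynomial 1 → Polynomial 1
  vertexBlockₚ c x = sum₃ₚ (λ i → sum₃ₚ (λ j → squareₚ (colourEntryₚ i j x :- colourEntryₚ i c x)))

  edgeBlockₚ : Fin 3 → Fin 3 → Polynomial 1 → Polynomial 1
  edgeBlockₚ a b x =
    sum₃ₚ (λ i → squareₚ (x :^ 5 :- (colourEntryₚ i a x :* x :^ 2 :+ colourEntryₚ i b x :* x :^ 2)))

colourEntry-vertexBlock : ∀ t c →
  sumFin 3 (λ i → sumFin 3 (λ j → let d = colourEntry t i j - colourEntry t i c in d * d)) ≡ fromℕ 4 * t ^ 6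
colourEntry-vertexBlock t 0F = solve 1 (λ x → vertexBlockₚ 0F x := con (fromℕ 4) :* x :^ 6) refl t
colourEntry-vertexBlock t 1F = solve 1 (λ x → vertexBlockₚ 1F x := con (fromℕ 4) :* x :^ 6) refl t
colourEntry-vertexBlock t 2F = solve 1 (λ x → vertexBlockₚ 2F x := con (fromℕ 4) :* x :^ 6) refl t

colourEntry-edgeBlock : ∀ t a b → a ≢ b →
  sumFin 3 (λ i → let d = t ^ 5 - (colourEntry t i a * t ^ 2 + colourEntry t i b * t ^ 2) in d * d) ≡ t ^ 10
colourEntry-edgeBlock t 0F 0F a≢b = ⊥-elim (a≢b refl)
colourEntry-edgeBlock t 1F 1F a≢b = ⊥-elim (a≢b refl)
colourEntry-edgeBlock t 2F 2F a≢b = ⊥-elim (a≢b refl)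
colourEntry-edgeBlock t 0F 1F _ = solve 1 (λ x → edgeBlockₚ 0F 1F x := x :^ 10) refl t
colourEntry-edgeBlock t 0F 2F _ = solve 1 (λ x → edgeBlockₚ 0F 2F x := x :^ 10) refl t
colourEntry-edgeBlock t 1F 0F _ = solve 1 (λ x → edgeBlockₚ 1F 0F x := x :^ 10) refl t
colourEntry-edgeBlock t 1F 2F _ = solve 1 (λ x → edgeBlockₚ 1F 2F x := x :^ 10) refl t
colourEntry-edgeBlock t 2F 0F _ = solve 1 (λ x → edgeBlockₚ 2F 0F x := x :^ 10) refl t
colourEntry-edgeBlock t 2F 1F _ = solve 1 (λ x → edgeBlockₚ 2F 1F x := x :^ 10) refl t

module Entries {n m} (G : SimpleGraph n m) where

  end₁ end₂ : Fin m → Fin n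
  end₁ e = proj₁ (ends G e)
  end₂ e = proj₂ (ends G e)

  𝓜-vertex-same : ∀ u i → 𝓜 G (vertexRow u) (vertexCol i u) ≡ 1ℚ
  𝓜-vertex-same u i with u ≟ u
  ... | yes _   = refl
  ... | no  u≢u = ⊥-elim (u≢u refl)

  𝓜-vertex-other : ∀ u i v → u ≢ v → 𝓜 G (vertexRow u) (vertexCol i v) ≡ 0ℚ
  𝓜-vertex-other u i v u≢v with u ≟ v
  ... | yes u≡v = ⊥-elim (u≢v u≡v)
  ... | no  _   = refl

  𝓜-vertex-edge-far : ∀ u e → u ≢ end₁ e → u ≢ end₂ e → 𝓜 G (vertexRow u) (edgeCol e) ≡ 0ℚ
  𝓜-vertex-edge-far u e u≢a u≢b with (u ≟ end₁ e) ⊎-dec (u ≟ end₂ e)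
  ... | yes (inj₁ u≡a) = ⊥-elim (u≢a u≡a)
  ... | yes (inj₂ u≡b) = ⊥-elim (u≢b u≡b)
  ... | no  _          = refl

  𝓜-vertex-edge-end₁ : ∀ e → 𝓜 G (vertexRow (end₁ e)) (edgeCol e) ≡ tpar n m ^ 2
  𝓜-vertex-edge-end₁ e with (end₁ e ≟ end₁ e) ⊎-dec (end₁ e ≟ end₂ e)
  ... | yes _         = refl
  ... | no  ¬incident = ⊥-elim (¬incident (inj₁ refl))

  𝓜-vertex-edge-end₂ : ∀ e → 𝓜 G (vertexRow (end₂ e)) (edgeCol e) ≡ tpar n m ^ 2
  𝓜-vertex-edge-end₂ e with (end₂ e ≟ end₁ e) ⊎-dec (end₂ e ≟ end₂ e)
  ... | yes _         = refl
  ... | no  ¬incident = ⊥-elim (¬incident (inj₂ refl))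

  𝓜-colour-vertex : ∀ i j v → 𝓜 G (colourRow i) (vertexCol j v) ≡ colourEntry (tpar n m) i j
  𝓜-colour-vertex i j v with i ≟ j
  ... | yes _ = refl
  ... | no  _ = refl

module ColumnSelection {n m} (G : SimpleGraph n m) (φ : Fin n → Fin 3) (proper : IsThreeColoring G φ) where

  open Entries G

  t : ℚ
  t = tpar n m

  M : Row n → Col n m → ℚ
  M = 𝓜 G

  σ : Fin n → Col n m
  σ v = vertexCol (φ v) v

  A : Fin n → Col n m → ℚ
  A w = M (vertexRow w)

  SA : Row n → Col n m → ℚ
  SA r c = sumFin n (λ j → M r (σ j) * A j c)

  residualEntry : Row n → Col n m → ℚ
  residualEntry r c = (M r c - SA r c) * (M r c - SA r c)

  σ-injective : Injective _≡_ _≡_ σ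
  σ-injective {v} σv≡σw = cong (λ { (vertexCol _ w) → w ; (edgeCol _) → v }) σv≡σw

  SA-term-zeroˡ : ∀ r w c → M r (σ w) ≡ 0ℚ → M r (σ w) * A w c ≡ 0ℚ
  SA-term-zeroˡ r w c eq = trans (cong (_* A w c) eq) (*-zeroˡ (A w c))

  SA-term-zeroʳ : ∀ r w c → A w c ≡ 0ℚ → M r (σ w) * A w c ≡ 0ℚ
  SA-term-zeroʳ r w c eq = trans (cong (M r (σ w) *_) eq) (*-zeroʳ (M r (σ w)))

  SA-vertex : ∀ u c → SA (vertexRow u) c ≡ M (vertexRow u) c
  SA-vertex u c = begin
    SA (vertexRow u) c
      ≡⟨ sumFin-single n _ u (λ w w≢u →
           SA-term-zeroˡ (vertexRow u) w c (𝓜-vertex-other u (φ w) w (w≢u ∘ sym))) ⟩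
    M (vertexRow u) (σ u) * A u c  ≡⟨ cong (_* A u c) (𝓜-vertex-same u (φ u)) ⟩
    1ℚ * A u c                     ≡⟨ *-identityˡ (A u c) ⟩
    M (vertexRow u) c              ∎
    where open ≡-Reasoning

  SA-ε : ∀ c → SA εRow c ≡ 0ℚ
  SA-ε c = sumFin-zero n (λ w → *-zeroˡ (A w c))

  SA-colour-vertex : ∀ i j v → SA (colourRow i) (vertexCol j v) ≡ colourEntry t i (φ v)
  SA-colour-vertex i j v = begin
    SA (colourRow i) (vertexCol j v)
      ≡⟨ sumFin-single n _ v (λ w w≢v →
           SA-term-zeroʳ (colourRow i) w (vertexCol j v) (𝓜-vertex-other w j v w≢v)) ⟩
    M (colourRow i) (σ v) * A v (vertexCol j v)
      ≡⟨ cong₂ _*_ (𝓜-colour-vertex i (φ v) v) (𝓜-vertex-same v j) ⟩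
    colourEntry t i (φ v) * 1ℚ
      ≡⟨ *-identityʳ _ ⟩
    colourEntry t i (φ v) ∎
    where open ≡-Reasoning

  SA-colour-edge : ∀ i e →
    SA (colourRow i) (edgeCol e) ≡ colourEntry t i (φ (end₁ e)) * t ^ 2 + colourEntry t i (φ (end₂ e)) * t ^ 2
  SA-colour-edge i e = begin
    SA (colourRow i) (edgeCol e)
      ≡⟨ sumFin-pair n _ a b (noLoop G e) (λ w w≢a w≢b →
           SA-term-zeroʳ (colourRow i) w (edgeCol e) (𝓜-vertex-edge-far w e w≢a w≢b)) ⟩
    M (colourRow i) (σ a) * A a (edgeCol e) + M (colourRow i) (σ b) * A b (edgeCol e)
      ≡⟨ cong₂ _+_ (cong₂ _*_ (𝓜-colour-vertex i (φ a) a) (𝓜-vertex-edge-end₁ e))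
                   (cong₂ _*_ (𝓜-colour-vertex i (φ b) b) (𝓜-vertex-edge-end₂ e)) ⟩
    colourEntry t i (φ a) * t ^ 2 + colourEntry t i (φ b) * t ^ 2 ∎
    where
    open ≡-Reasoning
    a = end₁ e
    b = end₂ e

  vertexRows-residual : sumFin n (λ u → sumCol n m (residualEntry (vertexRow u))) ≡ 0ℚ
  vertexRows-residual = sumFin-zero n λ u → sumCol-zero n m λ c →
    trans (cong (λ s → (M (vertexRow u) c - s) * (M (vertexRow u) c - s)) (SA-vertex u c))
          (cong (λ d → d * d) (+-inverseʳ (M (vertexRow u) c)))

  εRow-residual : sumCol n m (residualEntry εRow) ≡ fromℕ m * t ^ 2
  εRow-residual = begin
    sumCol n m (residualEntry εRow)
      ≡⟨ cong₂ _+_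
           (sumFin-zero 3 λ i → sumFin-zero n λ v → cong (λ s → (0ℚ - s) * (0ℚ - s)) (SA-ε (vertexCol i v)))
           (sumFin-cong m (λ e → cong (λ s → (t - s) * (t - s)) (SA-ε (edgeCol e)))) ⟩
    0ℚ + sumFin m (λ _ → (t - 0ℚ) * (t - 0ℚ))
      ≡⟨ cong (0ℚ +_) (sumFin-const m _) ⟩
    0ℚ + fromℕ m * ((t - 0ℚ) * (t - 0ℚ))
      ≡⟨ solve 2 (λ x k → con 0ℚ :+ k :* ((x :- con 0ℚ) :* (x :- con 0ℚ)) := k :* x :^ 2) refl t (fromℕ m) ⟩
    fromℕ m * t ^ 2 ∎
    where open ≡-Reasoning

  colourRows-vertexColumns :
    sumFin 3 (λ i → sumFin 3 (λ j → sumFin n (λ v → residualEntry (colourRow i) (vertexCol j v))))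
    ≡ fromℕ n * (fromℕ 4 * t ^ 6)
  colourRows-vertexColumns = begin
    sumFin 3 (λ i → sumFin 3 (λ j → sumFin n (λ v → residual i j v)))
      ≡⟨ sumFin-cong 3 (λ i → sumFin-comm 3 n (residual i)) ⟩
    sumFin 3 (λ i → sumFin n (λ v → sumFin 3 (λ j → residual i j v)))
      ≡⟨ sumFin-comm 3 n (λ i v → sumFin 3 (λ j → residual i j v)) ⟩
    sumFin n (λ v → sumFin 3 (λ i → sumFin 3 (λ j → residual i j v)))
      ≡⟨ sumFin-cong n (λ v → sumFin-cong 3 λ i → sumFin-cong 3 λ j →
           cong₂ (λ x s → (x - s) * (x - s)) (𝓜-colour-vertex i j v) (SA-colour-vertex i j v)) ⟩
    sumFin n (λ v → sumFin 3 (λ i → sumFin 3 (λ j → let d = colourEntry t i j - colourEntry t i (φ v) in d * d)))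
      ≡⟨ sumFin-cong n (λ v → colourEntry-vertexBlock t (φ v)) ⟩
    sumFin n (λ _ → fromℕ 4 * t ^ 6)
      ≡⟨ sumFin-const n _ ⟩
    fromℕ n * (fromℕ 4 * t ^ 6) ∎
    where
    open ≡-Reasoning
    residual : Fin 3 → Fin 3 → Fin n → ℚ
    residual i j v = residualEntry (colourRow i) (vertexCol j v)

  colourRows-edgeColumns :
    sumFin 3 (λ i → sumFin m (λ e → residualEntry (colourRow i) (edgeCol e))) ≡ fromℕ m * t ^ 10
  colourRows-edgeColumns = begin
    sumFin 3 (λ i → sumFin m (λ e → residualEntry (colourRow i) (edgeCol e)))
      ≡⟨ sumFin-comm 3 m (λ i e → residualEntry (colourRow i) (edgeCol e)) ⟩
    sumFin m (λ e → sumFin 3 (λ i → residualEntry (colourRow i) (edgeCol e)))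
      ≡⟨ sumFin-cong m (λ e →
           trans (sumFin-cong 3 λ i → cong (λ s → (t ^ 5 - s) * (t ^ 5 - s)) (SA-colour-edge i e))
                 (colourEntry-edgeBlock t _ _ (proper e))) ⟩
    sumFin m (λ _ → t ^ 10)
      ≡⟨ sumFin-const m _ ⟩
    fromℕ m * t ^ 10 ∎
    where open ≡-Reasoning

  colourRows-residual :
    sumFin 3 (λ i → sumCol n m (residualEntry (colourRow i))) ≡ fromℕ n * (fromℕ 4 * t ^ 6) + fromℕ m * t ^ 10
  colourRows-residual =
    trans (sumFin-distrib-+ 3 (λ i → sumFin 3 (λ j → sumFin n (λ v → residualEntry (colourRow i) (vertexCol j v))))
                              (λ i → sumFin m (λ e → residualEntry (colourRow i) (edgeCol e))))
          (cong₂ _+_ colourRows-vertexColumns colourRows-edgeColumns)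

  residual²-σ-A : residual² n M σ A ≡ (fromℕ m * t ^ 2 + fromℕ (4 ℕ.* n) * t ^ 6) + fromℕ m * t ^ 10
  residual²-σ-A = begin
    residual² n M σ A
      ≡⟨ cong₂ _+_ vertexRows-residual (cong₂ _+_ colourRows-residual εRow-residual) ⟩
    0ℚ + ((fromℕ n * (fromℕ 4 * t ^ 6) + fromℕ m * t ^ 10) + fromℕ m * t ^ 2)
      ≡⟨ solve 4 (λ x k l four → con 0ℚ :+ ((k :* (four :* x :^ 6) :+ l :* x :^ 10) :+ l :* x :^ 2)
                                 := (l :* x :^ 2 :+ (four :* k) :* x :^ 6) :+ l :* x :^ 10)
                 refl t (fromℕ n) (fromℕ m) (fromℕ 4) ⟩
    (fromℕ m * t ^ 2 + (fromℕ 4 * fromℕ n) * t ^ 6) + fromℕ m * t ^ 10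
      ≡⟨ cong (λ k → (fromℕ m * t ^ 2 + k * t ^ 6) + fromℕ m * t ^ 10) (sym (fromℕ-* 4 n)) ⟩
    (fromℕ m * t ^ 2 + fromℕ (4 ℕ.* n) * t ^ 6) + fromℕ m * t ^ 10 ∎
    where open ≡-Reasoning

lemma5p1 : (n m : ℕ) → 1 ≤ n → 1 ≤ m → (G : SimpleGraph n m) → ThreeColorable G →
    Σ (Fin n → Col n m) λ σ → Σ (Fin n → Col n m → ℚ) λ A →
      Injective _≡_ _≡_ σ ×
      (residual² n (𝓜 G) σ A ≤ℚ
        (fromℕ m * (tpar n m ^ 2) + fromℕ (4 Data.Nat.* n) * (tpar n m ^ 6)) + fromℕ m * (tpar n m ^ 10))
lemma5p1 n m _ _ G (φ , proper) = σ , A , σ-injective , ≤-reflexive residual²-σ-A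
  where open ColumnSelection G φ proper
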